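{- Let $(A,+,\times)$ be an infinite commutative unitary ring and let $(G,+)$ be an infinite subgroup of $(A,+)$. Then there are infinitely many irreducible $\lambda$-quiddities over $G$.
   Context: For $a_1,\dots,a_n\in A$, set $M_n(a_1,\ldots,a_n)=\begin{pmatrix} a_n & -1_A\\ 1_A & 0_A\end{pmatrix}\cdots\begin{pmatrix} a_1 & -1_A\\ 1_A & 0_A\end{pmatrix}$. An $n$-tuple $(a_1,\dots,a_n)\in G^n$ is a $\lambda$-quiddity over $G$ if $M_n(a_1,\dots,a_n)=\pm\mathrm{Id}$. Define $(a_1,\dots,a_n)\oplus(b_1,\dots,b_m)=(a_1+b_m,a_2,\dots,a_{n-1},a_n+b_1,b_2,\dots,b_{m-1})$. Write $\sim$ for equivalence of tuples up to cyclic rotation and reversal. A $\lambda$-quiddity $(c_1,\dots,c_n)$ over $G$ with $n\ge3$ is reducible if $(c_1,\dots,c_n)\sim(a_1,\dots,a_m)\oplus(b_1,\dots,b_l)$ for some $(a_1,\dots,a_m)\in G^m$ and some $\lambda$-quiddity $(b_1,\dots,b_l)$ over $G$, with $m,l\ge3$. It is irreducible otherwise; $(0_A,0_A)$ is not considered irreducible. -}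

module Defs where

open import Level using (Level; _⊔_)
open import Algebra.Bundles using (CommutativeRing)
open import Data.Nat using (ℕ; _≥_)
open import Data.List using (List; []; _∷_; _++_; length; drop; take; reverse)
open import Data.List.Relation.Unary.All using (All)
open import Data.List.Relation.Binary.Pointwise using (Pointwise)
open import Data.Product using (Σ; ∃; _×_; _,_)
open import Data.Sum using (_⊎_)
open import Relation.Nullary using (¬_)

module Quiddity {c ℓ : Level} (R : CommutativeRing c ℓ) where
  open CommutativeRing R

  record M2 : Set c where
    constructor mat
    field
      m11 m12 m21 m22 : Carrier
  open M2 public

  _·_ : M2 → M2 → M2
  mat a b c' d · mat e f g h =
    mat (a * e + b * g) (a * f + b * h) (c' * e + d * g) (c' * f + d * h)

  _≈M_ : M2 → M2 → Set ℓ
  mat a b c' d ≈M mat e f g h = (a ≈ e) × (b ≈ f) × (c' ≈ g) × (d ≈ h)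

  IdM : M2
  IdM = mat 1# 0# 0# 1#

  negIdM : M2
  negIdM = mat (- 1#) 0# 0# (- 1#)

  E : Carrier → M2
  E a = mat a (- 1#) 1# 0#

  Mn : List Carrier → M2
  Mn []       = IdM
  Mn (a ∷ as) = Mn as · E a

  IsLambdaQuiddity : ∀ {g} → (Carrier → Set g) → List Carrier → Set (g ⊔ c ⊔ ℓ)
  IsLambdaQuiddity G cs = All G cs × ((Mn cs ≈M IdM) ⊎ (Mn cs ≈M negIdM))

  lastOr : List Carrier → Carrier
  lastOr []           = 0#
  lastOr (x ∷ [])     = x
  lastOr (x ∷ y ∷ xs) = lastOr (y ∷ xs)

  dropLast : List Carrier → List Carrier
  dropLast []           = []
  dropLast (x ∷ [])     = []
  dropLast (x ∷ y ∷ xs) = x ∷ dropLast (y ∷ xs)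

  tail : List Carrier → List Carrier
  tail []       = []
  tail (_ ∷ xs) = xs

  addLast : Carrier → List Carrier → List Carrier
  addLast x []           = []
  addLast x (y ∷ [])     = (y + x) ∷ []
  addLast x (y ∷ z ∷ zs) = y ∷ addLast x (z ∷ zs)

  addHead : Carrier → List Carrier → List Carrier
  addHead x []       = []
  addHead x (y ∷ ys) = (y + x) ∷ ys

  -- (a_1,...,a_n) ⊕ (b_1,...,b_m) = (a_1+b_m, a_2,...,a_{n-1}, a_n+b_1, b_2,...,b_{m-1})
  _⊕_ : List Carrier → List Carrier → List Carrier
  as ⊕ bs = addHead (lastOr bs) (addLast (lastOr (take 1 bs)) as) ++ dropLast (tail bs)

  _≋_ : List Carrier → List Carrier → Set (c ⊔ ℓ)
  _≋_ = Pointwise _≈_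

  rotate : ℕ → List Carrier → List Carrier
  rotate k xs = drop k xs ++ take k xs

  _∼_ : List Carrier → List Carrier → Set (c ⊔ ℓ)
  xs ∼ ys = ∃ λ k → (rotate k xs ≋ ys) ⊎ (rotate k (reverse xs) ≋ ys)

  Reducible : ∀ {g} → (Carrier → Set g) → List Carrier → Set (g ⊔ c ⊔ ℓ)
  Reducible G cs =
    Σ (List Carrier) λ as → Σ (List Carrier) λ bs →
      (length as ≥ 3) × (length bs ≥ 3) × All G as × IsLambdaQuiddity G bs
      × (cs ∼ (as ⊕ bs))

  Irreducible : ∀ {g} → (Carrier → Set g) → List Carrier → Set (g ⊔ c ⊔ ℓ)
  Irreducible G cs = IsLambdaQuiddity G cs × (length cs ≥ 3) × ¬ Reducible G cs

  record IsSubgroup {g} (G : Carrier → Set g) : Set (g ⊔ c ⊔ ℓ) where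
    field
      respects : ∀ {x y} → x ≈ y → G x → G y
      zero∈    : G 0#
      +-closed : ∀ {x y} → G x → G y → G (x + y)
      neg-closed : ∀ {x} → G x → G (- x)

  InfiniteSubset : ∀ {g} → (Carrier → Set g) → Set (g ⊔ c ⊔ ℓ)
  InfiniteSubset G = (L : List Carrier) → Σ Carrier λ x → G x × All (λ y → ¬ (x ≈ y)) L

  InfiniteRing : Set (c ⊔ ℓ)
  InfiniteRing = (L : List Carrier) → Σ Carrier λ x → All (λ y → ¬ (x ≈ y)) L

  InfinitelyManyIrreducible : ∀ {g} → (Carrier → Set g) → Set (g ⊔ c ⊔ ℓ)
  InfinitelyManyIrreducible G =
    (L : List (List Carrier)) →
      Σ (List Carrier) λ cs → Irreducible G cs × All (λ ds → ¬ (cs ≋ ds)) L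

-- For every a the 4-tuple (a, 0, -a, 0) is a λ-quiddity, with M₄ = Id. Writing a 4-tuple as
-- (a₁,a₂,a₃) ⊕ (b₁,b₂,b₃) = (a₁+b₃, a₂, a₃+b₁, b₂) forces (b₁,b₂,b₃) to be a λ-quiddity,
-- and the bottom-right entry of M₃(b₁,b₂,b₃) is -b₂, so b₂ = ±1. Hence a 4-tuple none of
-- whose entries is ±1 is irreducible, and infinitely many a ∈ G make (a, 0, -a, 0) such a tuple.
module Submission where

open import Defs
open import Level using (Level)
open import Algebra.Bundles using (CommutativeRing)
open Quiddity using (InfiniteRing; IsSubgroup; InfiniteSubset; InfinitelyManyIrreducible)

open import Data.Nat as ℕ using (zero; suc; _∸_; _≥_; s≤s; z≤n)
open import Data.Nat.Properties using (m+1+n≢0)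
open import Data.List using ([]; _∷_; length; take; drop; reverse; concat)
open import Data.List.Properties using (length-++; take++drop≡id)
open import Data.List.Membership.Propositional using (_∈_)
open import Data.List.Relation.Unary.Any using (here; there)
open import Data.List.Relation.Unary.All as All using (All; []; _∷_)
open import Data.List.Relation.Unary.All.Properties using (concat⁻)
open import Data.List.Relation.Binary.Pointwise using (_∷_; Pointwise-length; All-resp-Pointwise)
open import Data.List.Relation.Binary.Permutation.Propositional
  using (_↭_; ↭-sym; ↭-trans; ↭-reflexive)
open import Data.List.Relation.Binary.Permutation.Propositional.Properties
  using (++-comm; ↭-reverse; ↭-length; All-resp-↭)
open import Data.Product using (Σ; ∃; _×_; _,_; proj₂)
open import Data.Sum using (_⊎_; inj₁; inj₂; [_,_])
open import Function using (_∘_)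
open import Relation.Nullary using (¬_)
open import Relation.Binary.PropositionalEquality as ≡ using (_≡_)

m+[n∸2]≡4⇒m≡3×n≡3 : ∀ {m n} → m ≥ 3 → n ≥ 3 → m ℕ.+ (n ∸ 2) ≡ 4 → m ≡ 3 × n ≡ 3
m+[n∸2]≡4⇒m≡3×n≡3 (s≤s (s≤s (s≤s (z≤n {zero})))) (s≤s (s≤s (s≤s (z≤n {zero})))) _ = ≡.refl , ≡.refl
m+[n∸2]≡4⇒m≡3×n≡3 (s≤s (s≤s (s≤s (z≤n {zero})))) (s≤s (s≤s (s≤s (z≤n {suc _})))) ()
m+[n∸2]≡4⇒m≡3×n≡3 (s≤s (s≤s (s≤s (z≤n {suc m})))) (s≤s (s≤s (s≤s z≤n))) eq
  with () ← m+1+n≢0 m (≡.cong (_∸ 4) eq)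

module ⊕-Properties {c ℓ : Level} (R : CommutativeRing c ℓ) where
  open CommutativeRing R using (Carrier; _+_)
  open Quiddity R using (addLast; addHead; dropLast; tail; _⊕_; rotate; _∼_; _≋_)
  open ≡ using (refl; sym; trans; cong; cong₂; subst)

  length-addLast : ∀ x xs → length (addLast x xs) ≡ length xs
  length-addLast x []           = refl
  length-addLast x (y ∷ [])     = refl
  length-addLast x (y ∷ z ∷ zs) = cong suc (length-addLast x (z ∷ zs))

  length-addHead : ∀ x xs → length (addHead x xs) ≡ length xs
  length-addHead x []       = refl
  length-addHead x (y ∷ ys) = refl

  length-dropLast : ∀ xs → length (dropLast xs) ≡ length xs ∸ 1
  length-dropLast []           = refl
  length-dropLast (x ∷ [])     = refl
  length-dropLast (x ∷ y ∷ xs) = cong suc (length-dropLast (y ∷ xs))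

  length-⊕ : ∀ as bs → length (as ⊕ bs) ≡ length as ℕ.+ (length bs ∸ 2)
  length-⊕ as bs = trans (length-++ (addHead _ (addLast _ as)))
    (cong₂ ℕ._+_ (trans (length-addHead _ (addLast _ as)) (length-addLast _ as)) (length-dropLast-tail bs))
    where
    length-dropLast-tail : ∀ bs → length (dropLast (tail bs)) ≡ length bs ∸ 2
    length-dropLast-tail []       = refl
    length-dropLast-tail (_ ∷ bs) = length-dropLast bs

  length≡3⇒triple : ∀ xs → length xs ≡ 3 → Σ (Carrier × Carrier × Carrier) λ (x , y , z) → xs ≡ x ∷ y ∷ z ∷ []
  length≡3⇒triple (x ∷ y ∷ z ∷ []) refl = (x , y , z) , refl

  ⊕-triples : ∀ {a₁ a₂ a₃ b₁ b₂ b₃} →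
              (a₁ ∷ a₂ ∷ a₃ ∷ []) ⊕ (b₁ ∷ b₂ ∷ b₃ ∷ []) ≡ (a₁ + b₃) ∷ a₂ ∷ (a₃ + b₁) ∷ b₂ ∷ []
  ⊕-triples = refl

  ⊕-of-length-4 : ∀ as bs → length as ≥ 3 → length bs ≥ 3 → length (as ⊕ bs) ≡ 4 →
                  Σ (Carrier × Carrier × Carrier) λ (b₁ , b₂ , b₃) → bs ≡ b₁ ∷ b₂ ∷ b₃ ∷ [] × b₂ ∈ as ⊕ bs
  ⊕-of-length-4 as bs |as|≥3 |bs|≥3 |as⊕bs|≡4
    with |as|≡3 , |bs|≡3 ← m+[n∸2]≡4⇒m≡3×n≡3 |as|≥3 |bs|≥3 (trans (sym (length-⊕ as bs)) |as⊕bs|≡4)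
    with _ , refl ← length≡3⇒triple as |as|≡3
    with (b₁ , b₂ , b₃) , refl ← length≡3⇒triple bs |bs|≡3
    = (b₁ , b₂ , b₃) , refl , subst (b₂ ∈_) (sym ⊕-triples) (there (there (there (here refl))))

  rotate-↭ : ∀ k xs → rotate k xs ↭ xs
  rotate-↭ k xs = ↭-trans (++-comm (drop k xs) (take k xs)) (↭-reflexive (take++drop≡id k xs))

  ∼⇒↭-≋ : ∀ {xs zs} → xs ∼ zs → ∃ λ ys → ys ↭ xs × ys ≋ zs
  ∼⇒↭-≋ {xs} (k , inj₁ rotation≋)  = rotate k xs , rotate-↭ k xs , rotation≋
  ∼⇒↭-≋ {xs} (k , inj₂ reflection≋) =
    rotate k (reverse xs) , ↭-trans (rotate-↭ k (reverse xs)) (↭-reverse xs) , reflection≋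

module QuiddityProperties {c ℓ : Level} (R : CommutativeRing c ℓ) where
  open CommutativeRing R
  open Quiddity R hiding (InfiniteRing; IsSubgroup; InfiniteSubset; InfinitelyManyIrreducible)
  open Quiddity.IsSubgroup
  open ⊕-Properties R
  open import Algebra.Properties.Ring ring using (-1*x≈-x; -‿distribʳ-*; -‿involutive; -0#≈0#)

  x*-1≈-x : ∀ x → x * - 1# ≈ - x
  x*-1≈-x x = trans (sym (-‿distribʳ-* x 1#)) (-‿cong (*-identityʳ x))

  ≈M-refl : ∀ {X} → X ≈M X
  ≈M-refl = refl , refl , refl , refl

  ≈M-trans : ∀ {X Y Z} → X ≈M Y → Y ≈M Z → X ≈M Z
  ≈M-trans (p₁ , q₁ , r₁ , s₁) (p₂ , q₂ , r₂ , s₂) =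
    trans p₁ p₂ , trans q₁ q₂ , trans r₁ r₂ , trans s₁ s₂

  Mn-∷ : ∀ x xs {p q r s} → Mn xs ≈M mat p q r s →
         Mn (x ∷ xs) ≈M mat (p * x + q) (- p) (r * x + s) (- r)
  Mn-∷ x xs (p , q , r , s) =
      +-cong (*-cong p refl) (trans (*-identityʳ _) q)
    , first-column↦second p
    , +-cong (*-cong r refl) (trans (*-identityʳ _) s)
    , first-column↦second r
    where
    first-column↦second : ∀ {y y′ z} → y ≈ y′ → y * - 1# + z * 0# ≈ - y′
    first-column↦second y≈y′ =
      trans (+-cong (x*-1≈-x _) (zeroʳ _)) (trans (+-identityʳ _) (-‿cong y≈y′))

  Mn-a0-a0≈Id : ∀ a → Mn (a ∷ 0# ∷ - a ∷ 0# ∷ []) ≈M IdM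
  Mn-a0-a0≈Id a =
    ≈M-trans (Mn-∷ a (0# ∷ - a ∷ 0# ∷ []) M₃)
      ( trans (+-cong (zeroˡ a) refl) (+-identityˡ 1#) , -0#≈0#
      , trans (+-cong (-1*x≈-x a) refl) (-‿inverseˡ a) , -‿involutive 1# )
    where
    M₁ : Mn (0# ∷ []) ≈M mat 0# (- 1#) 1# 0#
    M₁ = ≈M-trans (Mn-∷ 0# [] ≈M-refl)
      (trans (+-identityʳ _) (zeroʳ 1#) , refl , trans (+-cong (zeroˡ 0#) refl) (+-identityˡ 1#) , -0#≈0#)
    M₂ : Mn (- a ∷ 0# ∷ []) ≈M mat (- 1#) 0# (- a) (- 1#)
    M₂ = ≈M-trans (Mn-∷ (- a) (0# ∷ []) M₁)
      (trans (+-cong (zeroˡ _) refl) (+-identityˡ _) , -0#≈0# , trans (+-identityʳ _) (*-identityˡ _) , refl)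
    M₃ : Mn (0# ∷ - a ∷ 0# ∷ []) ≈M mat 0# 1# (- 1#) a
    M₃ = ≈M-trans (Mn-∷ 0# (- a ∷ 0# ∷ []) M₂)
      (trans (+-identityʳ _) (zeroʳ _) , -‿involutive 1# , trans (+-cong (zeroʳ _) refl) (+-identityˡ _) , -‿involutive a)

  m22-Mn-triple : ∀ b₁ b₂ b₃ → m22 (Mn (b₁ ∷ b₂ ∷ b₃ ∷ [])) ≈ - b₂
  m22-Mn-triple b₁ b₂ b₃ =
    trans (proj₂ (proj₂ (proj₂ (Mn-∷ b₁ (b₂ ∷ b₃ ∷ []) (Mn-∷ b₂ (b₃ ∷ []) (Mn-∷ b₃ [] ≈M-refl))))))
          (-‿cong bottom-left)
    where
    bottom-left : (0# * b₃ + 1#) * b₂ + - 0# ≈ b₂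
    bottom-left = trans (+-cong (*-cong (trans (+-cong (zeroˡ b₃) refl) (+-identityˡ 1#)) refl) -0#≈0#)
                        (trans (+-identityʳ _) (*-identityˡ b₂))

  Is±1 : Carrier → Set ℓ
  Is±1 x = x ≈ 1# ⊎ x ≈ - 1#

  Is±1-resp-≈ : ∀ {x y} → x ≈ y → Is±1 x → Is±1 y
  Is±1-resp-≈ x≈y (inj₁ x≈1)  = inj₁ (trans (sym x≈y) x≈1)
  Is±1-resp-≈ x≈y (inj₂ x≈-1) = inj₂ (trans (sym x≈y) x≈-1)

  Is±1-neg : ∀ {x} → Is±1 x → Is±1 (- x)
  Is±1-neg (inj₁ x≈1)  = inj₂ (-‿cong x≈1)
  Is±1-neg (inj₂ x≈-1) = inj₁ (trans (-‿cong x≈-1) (-‿involutive 1#))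

  Is±1-0#⇒Is±1 : Is±1 0# → ∀ x → Is±1 x
  Is±1-0#⇒Is±1 0#±1 x = inj₁ (x≈1 (0#≈1# 0#±1))
    where
    0#≈1# : Is±1 0# → 0# ≈ 1#
    0#≈1# (inj₁ 0≈1)  = 0≈1
    0#≈1# (inj₂ 0≈-1) = trans (sym -0#≈0#) (trans (-‿cong 0≈-1) (-‿involutive 1#))
    x≈1 : 0# ≈ 1# → x ≈ 1#
    x≈1 0≈1 = trans (sym (*-identityʳ x)) (trans (*-cong refl (sym 0≈1)) (trans (zeroʳ x) 0≈1))

  triple-quiddity⇒middle-Is±1 : ∀ {g} {G : Carrier → Set g} {b₁ b₂ b₃} →
                                IsLambdaQuiddity G (b₁ ∷ b₂ ∷ b₃ ∷ []) → Is±1 b₂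
  triple-quiddity⇒middle-Is±1 {b₁ = b₁} {b₂} {b₃} (_ , M≈±Id) =
    Is±1-resp-≈ (-‿involutive b₂) (Is±1-neg (Is±1-resp-≈ (m22-Mn-triple b₁ b₂ b₃) (m22≈±1 M≈±Id)))
    where
    m22≈±1 : ∀ {M} → (M ≈M IdM) ⊎ (M ≈M negIdM) → Is±1 (m22 M)
    m22≈±1 (inj₁ (_ , _ , _ , s)) = inj₁ s
    m22≈±1 (inj₂ (_ , _ , _ , s)) = inj₂ s

  ¬Is±1-resp-≈ : ∀ {x y} → x ≈ y → ¬ Is±1 x → ¬ Is±1 y
  ¬Is±1-resp-≈ x≈y ¬x±1 y±1 = ¬x±1 (Is±1-resp-≈ (sym x≈y) y±1)

  ¬Reducible-of-length-4 : ∀ {g} {G : Carrier → Set g} {cs} →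
                           length cs ≡ 4 → All (¬_ ∘ Is±1) cs → ¬ Reducible G cs
  ¬Reducible-of-length-4 {cs = cs} |cs|≡4 no±1 (as , bs , |as|≥3 , |bs|≥3 , _ , bs-quiddity , cs∼as⊕bs)
    with ys , ys↭cs , ys≋as⊕bs ← ∼⇒↭-≋ cs∼as⊕bs
    with (_ , b₂ , _) , ≡.refl , b₂∈as⊕bs ← ⊕-of-length-4 as bs |as|≥3 |bs|≥3
           (≡.trans (≡.sym (Pointwise-length ys≋as⊕bs)) (≡.trans (↭-length ys↭cs) |cs|≡4))
    = All.lookup (All-resp-Pointwise ¬Is±1-resp-≈ ys≋as⊕bs (All-resp-↭ (↭-sym ys↭cs) no±1))
                 b₂∈as⊕bs (triple-quiddity⇒middle-Is±1 bs-quiddity)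

  a0-a0-irreducible : ∀ {g} {G : Carrier → Set g} → IsSubgroup R G →
                      ∀ {a} → G a → ¬ Is±1 a → Irreducible G (a ∷ 0# ∷ - a ∷ 0# ∷ [])
  a0-a0-irreducible G-subgroup a∈G a≉±1 =
      ((a∈G ∷ zero∈ G-subgroup ∷ neg-closed G-subgroup a∈G ∷ zero∈ G-subgroup ∷ []) , inj₁ (Mn-a0-a0≈Id _))
    , s≤s (s≤s (s≤s z≤n))
    , ¬Reducible-of-length-4 ≡.refl (a≉±1 ∷ 0≉±1 ∷ a≉±1 ∘ -a±1⇒a±1 ∷ 0≉±1 ∷ [])
    where
    0≉±1 : ¬ Is±1 0#
    0≉±1 0±1 = a≉±1 (Is±1-0#⇒Is±1 0±1 _)
    -a±1⇒a±1 : Is±1 (- _) → Is±1 _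
    -a±1⇒a±1 -a±1 = Is±1-resp-≈ (-‿involutive _) (Is±1-neg -a±1)

  ≋-head-∉ : ∀ {x xs ds} → All (λ d → ¬ x ≈ d) ds → ¬ (x ∷ xs) ≋ ds
  ≋-head-∉ (x≉d ∷ _) (x≈d ∷ _) = x≉d x≈d

  infinitely-many-irreducible : ∀ {g} {G : Carrier → Set g} → IsSubgroup R G →
                                InfiniteSubset R G → InfinitelyManyIrreducible R G
  infinitely-many-irreducible G-subgroup G-infinite L
    with a , a∈G , a≉1 ∷ a≉-1 ∷ a∉L ← G-infinite (1# ∷ - 1# ∷ concat L)
    = (a ∷ 0# ∷ - a ∷ 0# ∷ [])
    , a0-a0-irreducible G-subgroup a∈G [ a≉1 , a≉-1 ]
    , All.map ≋-head-∉ (concat⁻ a∉L)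

-- An infinite subgroup already makes the ring infinite.
proposition2p10 : {c ℓ g : Level} (R : CommutativeRing c ℓ) → InfiniteRing R
    → (G : CommutativeRing.Carrier R → Set g) → IsSubgroup R G → InfiniteSubset R G
    → InfinitelyManyIrreducible R G
proposition2p10 R _ G = QuiddityProperties.infinitely-many-irreducible R
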